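{- Let $\mathscr{A}\in\mathbb{K}\langle\langle\mathbb{X}\rangle\rangle$ be the language of shift plethystic trees. Then $$\mathscr{A}=X_0\,(\sigma\mathscr{C}^{(1)})^{ -1}\,\mathscr{C}^{(1)},$$ where $\mathscr{C}^{(1)}=\sum_{\kappa}X_\kappa$ over all compositions (empty included) with $\kappa_{i+1}-\kappa_i\le1$, and $\sigma\mathscr{C}^{(1)}$ is the corresponding sum over those compositions with all parts $\ge2$.
   Context: $\mathbb{X}=\{X_0,X_1,\dots\}$, $\mathbb{K}$ a field of characteristic zero; $X_\kappa=X_{\kappa_1}\cdots X_{\kappa_m}$; compositions have all parts $\ge1$. $\sigma$ is the continuous algebra endomorphism with $\sigma X_i=X_{i+1}$. A shift plethystic tree is a finite plane rooted tree each vertex colored by its height; its word $\omega_T$ lists the vertices in preorder writing $X_h$ for a vertex of height $h$, and $\mathscr{A}=\sum_T\omega_T$. -}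

module Defs where

open import Level using (Level)
open import Data.Nat using (ℕ; zero; suc; pred; _≤ᵇ_)
open import Data.Bool using (Bool; true; false; _∧_; if_then_else_)
open import Data.List using (List; []; _∷_; _++_; map; foldr; zipWith)
open import Data.Product using (_×_; _,_; Σ; ∃)
open import Data.Fin using (Fin)
open import Function.Bundles using (_↔_)
open import Relation.Binary.PropositionalEquality using (_≡_)
open import Relation.Nullary using (¬_)
open import Algebra.Bundles using (CommutativeRing)

-- Words over the alphabet 𝕏 = {X₀, X₁, …}: a word X_{i₁}⋯X_{iₘ} is the
-- list [i₁, …, iₘ] of indices.

Word : Set
Word = List ℕ

splits : Word → List (Word × Word)
splits []      = ([] , []) ∷ []
splits (a ∷ w) = ([] , a ∷ w) ∷ map (λ { (u , v) → (a ∷ u , v) }) (splits w)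

-- Shift plethystic trees: finite plane rooted trees; a vertex of height h
-- is coloured h, so the tree is determined by its shape.

data Tree : Set where
  node : List Tree → Tree

mutual
  ωAt : ℕ → Tree → Word
  ωAt h (node ts) = h ∷ ωForest (suc h) ts

  ωForest : ℕ → List Tree → Word
  ωForest h []       = []
  ωForest h (t ∷ ts) = ωAt h t ++ ωForest h ts

ω : Tree → Word
ω = ωAt 0

isC1 : Word → Bool
isC1 []          = true
isC1 (a ∷ [])    = 1 ≤ᵇ a
isC1 (a ∷ b ∷ w) = (1 ≤ᵇ a) ∧ ((b ≤ᵇ suc a) ∧ isC1 (b ∷ w))

allPos : Word → Bool
allPos []      = true
allPos (a ∷ w) = (1 ≤ᵇ a) ∧ allPos w

module Series {c ℓ : Level} (K : CommutativeRing c ℓ) where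
  open CommutativeRing K

  natToK : ℕ → Carrier
  natToK zero    = 0#
  natToK (suc n) = 1# + natToK n

  IsField : Set (c Level.⊔ ℓ)
  IsField = (¬ (1# ≈ 0#)) × (∀ x → ¬ (x ≈ 0#) → ∃ λ y → x * y ≈ 1#)

  CharZero : Set ℓ
  CharZero = ∀ n → natToK n ≈ 0# → n ≡ 0

  PS : Set c
  PS = Word → Carrier

  _≋_ : PS → PS → Set ℓ
  f ≋ g = ∀ w → f w ≈ g w

  Σ' : List Carrier → Carrier
  Σ' = foldr _+_ 0#

  _⊛_ : PS → PS → PS
  (f ⊛ g) w = Σ' (map (λ { (u , v) → f u * g v }) (splits w))

  X₀ : PS
  X₀ (0 ∷ []) = 1#
  X₀ _        = 0#

  C1 : PS
  C1 w = if isC1 w then 1# else 0#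

  -- σ : the continuous algebra endomorphism with σ X_i = X_{i+1};
  -- coefficient of w in σ f is f(w') if w = σ w', and 0 if w contains X₀.
  σ : PS → PS
  σ f w = if allPos w then f (map pred w) else 0#

  -- Inverse of a series f with constant term f [] = 1# (as is the case
  -- for σ 𝒞⁽¹⁾): g [] = 1#, g w = - Σ_{w = u v, u ≠ ε} f u * g v.
  -- invAll f w lists g on all suffixes of w: g w, g (tail w), …, g [].
  invAll : PS → Word → List Carrier
  invAll f []      = 1# ∷ []
  invAll f (a ∷ w) =
    - Σ' (zipWith (λ { (u , _) r → f (a ∷ u) * r }) (splits w) (invAll f w))
    ∷ invAll f w

  inv₁ : PS → PS
  inv₁ f w with invAll f w
  ... | []    = 0#
  ... | x ∷ _ = x

  IsTreeLanguage : PS → Set ℓ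
  IsTreeLanguage A =
    Σ (Word → ℕ) λ count →
      (∀ w → Fin (count w) ↔ Σ Tree (λ T → ω T ≡ w)) ×
      (∀ w → A w ≈ natToK (count w))

-- Read in preorder, a tree gives X₀ followed by a word of 𝒟, the part of 𝒞⁽¹⁾
-- that is empty or starts with 1: after a vertex of height h the next one has
-- height at most h + 1, and heights below the root are ≥ 1. Parsing such a word
-- back into a tree is unambiguous, so 𝒜 = X₀ 𝒟. Cutting a word of
-- 𝒞⁽¹⁾ before its first part equal to 1 factors it uniquely as a composition with
-- all parts ≥ 2 followed by a word of 𝒟, that is 𝒞⁽¹⁾ = (σ𝒞⁽¹⁾) 𝒟; hence
-- 𝒟 = (σ𝒞⁽¹⁾)⁻¹ 𝒞⁽¹⁾.
module Submission where

open import Defs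
open import Level using (Level)
open import Algebra.Bundles using (CommutativeRing)
open import Data.Nat using (ℕ; zero; suc; pred; _≤_; _<_; z≤n; s≤s; _≤ᵇ_; _<ᵇ_)
open import Data.Nat.Properties using (≤-refl; ≤-pred; ≤-trans; ≤-antisym; ≮⇒≥; <-irrefl; _<?_; ≤⇒≤ᵇ; ≤ᵇ⇒≤; m≤n⇒m≤1+n)
open import Data.Bool using (Bool; true; false; T; _∧_; if_then_else_)
open import Data.Bool.Properties using (∧-identityʳ; T-∧)
open import Data.List using (List; []; _∷_; _++_; length; map; zipWith)
open import Data.List.Properties using (++-assoc; ++-identityʳ; ∷-injectiveˡ; ∷-injectiveʳ; map-∘)
open import Data.Product using (Σ; _×_; _,_; proj₁; proj₂)
open import Data.Unit using (⊤; tt)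
open import Data.Empty using (⊥-elim)
open import Data.Fin using (Fin; zero; suc)
open import Function using (_∘_)
open import Function.Bundles using (_↔_; Inverse; Injection; Equivalence)
open import Function.Properties.Inverse using (↔⇒↣)
open import Relation.Nullary using (¬_; Irrelevant; yes; no)
open import Relation.Binary.PropositionalEquality as ≡ using (_≡_)

zipWith-map-self : ∀ {a b c} {A : Set a} {B : Set b} {C : Set c}
                   (f : A → B → C) (g : A → B) xs →
                   zipWith f xs (map g xs) ≡ map (λ x → f x (g x)) xs
zipWith-map-self f g []       = ≡.refl
zipWith-map-self f g (x ∷ xs) = ≡.cong (f x (g x) ∷_) (zipWith-map-self f g xs)

Fin↔⊥⇒≡0 : ∀ {a} {S : Set a} n → Fin n ↔ S → ¬ S → n ≡ 0
Fin↔⊥⇒≡0 zero    i ¬s = ≡.refl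
Fin↔⊥⇒≡0 (suc n) i ¬s = ⊥-elim (¬s (Inverse.to i zero))

Fin↔Irrelevant⇒≡1 : ∀ {a} {S : Set a} n → Fin n ↔ S → S → Irrelevant S → n ≡ 1
Fin↔Irrelevant⇒≡1 zero          i s irr with Inverse.from i s
... | ()
Fin↔Irrelevant⇒≡1 (suc zero)    i s irr = ≡.refl
Fin↔Irrelevant⇒≡1 (suc (suc n)) i s irr with Injection.injective (↔⇒↣ i) {zero} {suc zero} (irr _ _)
... | ()

module TreeWords where
  open ≡ using (refl; sym; trans; cong; subst)

  -- isC1After m w: the word m w satisfies the conditions of 𝒞⁽¹⁾, except that m may be 0.
  isC1After : ℕ → Word → Bool
  isC1After m []      = true
  isC1After m (b ∷ w) = (b ≤ᵇ suc m) ∧ ((1 ≤ᵇ b) ∧ isC1After b w)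

  isTreeWord : Word → Bool
  isTreeWord (zero ∷ v) = isC1After 0 v
  isTreeWord _          = false

  isC1-∷ : ∀ a w → isC1 (a ∷ w) ≡ (1 ≤ᵇ a) ∧ isC1After a w
  isC1-∷ a []      = sym (∧-identityʳ _)
  isC1-∷ a (b ∷ w) = cong (λ z → (1 ≤ᵇ a) ∧ ((b ≤ᵇ suc a) ∧ z)) (isC1-∷ b w)

  isC1-0∷ : ∀ v → isC1 (0 ∷ v) ≡ false
  isC1-0∷ []      = refl
  isC1-0∷ (_ ∷ _) = refl

  isC1-∷⁺ : ∀ {a} w → 1 ≤ a → T (isC1After a w) → T (isC1 (a ∷ w))
  isC1-∷⁺ {a} w 1≤a p = subst T (sym (isC1-∷ a w)) (Equivalence.from T-∧ (≤⇒≤ᵇ 1≤a , p))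

  isC1-∷⁻ : ∀ {a} w → T (isC1 (a ∷ w)) → T (isC1After a w)
  isC1-∷⁻ {a} w p = proj₂ (Equivalence.to T-∧ (subst T (isC1-∷ a w) p))

  Below : ℕ → Word → Set
  Below h []      = ⊤
  Below h (x ∷ _) = x < h

  Below-suc : ∀ {h} r → Below h r → Below (suc h) r
  Below-suc []      _   = tt
  Below-suc (x ∷ _) x<h = m≤n⇒m≤1+n x<h

  isC1After⇒ : ∀ {m} v → T (isC1After m v) → T (isC1 v) × Below (suc (suc m)) v
  isC1After⇒ []      _ = tt , tt
  isC1After⇒ (b ∷ w) p with Equivalence.to T-∧ p
  ... | b≤m+1 , q = subst T (sym (isC1-∷ b w)) q , s≤s (≤ᵇ⇒≤ b _ b≤m+1)

  isC1After⇐ : ∀ {m} v → T (isC1 v) → Below (suc (suc m)) v → T (isC1After m v)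
  isC1After⇐ []      _ _         = tt
  isC1After⇐ (b ∷ w) p (s≤s b≤m+1) = Equivalence.from T-∧ (≤⇒≤ᵇ b≤m+1 , subst T (isC1-∷ b w) p)

  ωForest-Below : ∀ {h} ts r → Below (suc h) r → Below (suc h) (ωForest h ts ++ r)
  ωForest-Below []           r r<h+1 = r<h+1
  ωForest-Below (node _ ∷ _) r _     = ≤-refl

  mutual
    ωAt-isC1 : ∀ {h} t r → 1 ≤ h → T (isC1 r) → Below (suc h) r → T (isC1 (ωAt h t ++ r))
    ωAt-isC1 {h} (node ts) r 1≤h r∈C1 r<h+1 =
      isC1-∷⁺ (ωForest (suc h) ts ++ r) 1≤h (isC1After⇐ (ωForest (suc h) ts ++ r)
        (ωForest-isC1 ts r (s≤s z≤n) r∈C1 r<h+2)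
        (ωForest-Below ts r r<h+2))
      where r<h+2 = Below-suc r r<h+1

    ωForest-isC1 : ∀ {h} ts r → 1 ≤ h → T (isC1 r) → Below (suc h) r → T (isC1 (ωForest h ts ++ r))
    ωForest-isC1     []       r 1≤h r∈C1 r<h+1 = r∈C1
    ωForest-isC1 {h} (t ∷ ts) r 1≤h r∈C1 r<h+1
      rewrite ++-assoc (ωAt h t) (ωForest h ts) r =
      ωAt-isC1 t (ωForest h ts ++ r) 1≤h (ωForest-isC1 ts r 1≤h r∈C1 r<h+1) (ωForest-Below ts r r<h+1)

  ω-isTreeWord : ∀ t → T (isTreeWord (ω t))
  ω-isTreeWord (node ts) = subst (T ∘ isC1After 0) (++-identityʳ (ωForest 1 ts))
    (isC1After⇐ (ωForest 1 ts ++ []) (ωForest-isC1 ts [] ≤-refl tt tt) (ωForest-Below ts [] tt))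

  -- A tail starting strictly below height h cannot be mistaken for a further tree of
  -- height h: preorder words at height h form a prefix code for such tails.
  mutual
    ωAt-++-injective : ∀ {h} t t′ r r′ → Below (suc h) r → Below (suc h) r′ →
                       ωAt h t ++ r ≡ ωAt h t′ ++ r′ → t ≡ t′ × r ≡ r′
    ωAt-++-injective (node ts) (node ts′) r r′ r<h+1 r′<h+1 e
      with ωForest-++-injective ts ts′ r r′ r<h+1 r′<h+1 (∷-injectiveʳ e)
    ... | refl , r≡r′ = refl , r≡r′

    ωForest-++-injective : ∀ {h} ts ts′ r r′ → Below h r → Below h r′ →
                           ωForest h ts ++ r ≡ ωForest h ts′ ++ r′ → ts ≡ ts′ × r ≡ r′
    ωForest-++-injective [] [] r r′ _ _ e = refl , e
    ωForest-++-injective [] (node _ ∷ _) (x ∷ _) r′ x<h _ e = ⊥-elim (<-irrefl (∷-injectiveˡ e) x<h)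
    ωForest-++-injective (node _ ∷ _) [] r (x ∷ _) _ x<h e = ⊥-elim (<-irrefl (∷-injectiveˡ (sym e)) x<h)
    ωForest-++-injective {h} (t ∷ ts) (t′ ∷ ts′) r r′ r<h r′<h e
      with ωAt-++-injective t t′ (ωForest h ts ++ r) (ωForest h ts′ ++ r′)
             (ωForest-Below ts r (Below-suc r r<h)) (ωForest-Below ts′ r′ (Below-suc r′ r′<h))
             (trans (sym (++-assoc (ωAt h t) (ωForest h ts) r))
               (trans e (++-assoc (ωAt h t′) (ωForest h ts′) r′)))
    ... | refl , e′ with ωForest-++-injective ts ts′ r r′ r<h r′<h e′
    ... | refl , r≡r′ = refl , r≡r′

  ω-injective : ∀ t t′ → ω t ≡ ω t′ → t ≡ t′
  ω-injective t t′ e = proj₁ (ωAt-++-injective t t′ [] [] tt tt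
    (trans (++-identityʳ (ω t)) (trans e (sym (++-identityʳ (ω t′))))))

  ForestParse : ℕ → Word → Set
  ForestParse h v = Σ (List Tree) λ ts → Σ Word λ r →
    (ωForest h ts ++ r ≡ v) × Below h r × T (isC1 r) × length r ≤ length v

  parseForest : ∀ n h v → length v ≤ n → T (isC1 v) → Below (suc h) v → ForestParse h v
  parseForest n h [] _ _ _ = [] , [] , refl , tt , tt , ≤-refl
  parseForest n h (x ∷ v) _ v∈C1 x≤h with x <? h
  ... | yes x<h = [] , x ∷ v , refl , x<h , v∈C1 , ≤-refl
  ... | no x≮h with ≤-antisym (≤-pred x≤h) (≮⇒≥ x≮h)
  parseForest (suc n) h (h ∷ v) (s≤s |v|≤n) hv∈C1 _ | no _ | refl
    with isC1After⇒ v (isC1-∷⁻ v hv∈C1)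
  ... | v∈C1 , v<h+2
    with parseForest n (suc h) v |v|≤n v∈C1 v<h+2
  ... | ts₁ , r₁ , e₁ , r₁<h+1 , r₁∈C1 , |r₁|≤|v|
    with parseForest n h r₁ (≤-trans |r₁|≤|v| |v|≤n) r₁∈C1 r₁<h+1
  ... | ts₂ , r₂ , e₂ , r₂<h , r₂∈C1 , |r₂|≤|r₁| =
    node ts₁ ∷ ts₂ , r₂ ,
    cong (h ∷_) (trans (++-assoc (ωForest (suc h) ts₁) (ωForest h ts₂) r₂)
                       (trans (cong (ωForest (suc h) ts₁ ++_) e₂) e₁)) ,
    r₂<h , r₂∈C1 , m≤n⇒m≤1+n (≤-trans |r₂|≤|r₁| |r₁|≤|v|)

  isTreeWord⇒ω : ∀ w → T (isTreeWord w) → Σ Tree λ t → ω t ≡ w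
  isTreeWord⇒ω (zero ∷ v) p with isC1After⇒ v p
  ... | v∈C1 , v<2 with parseForest (length v) 1 v ≤-refl v∈C1 v<2
  ... | ts , []        , e , _ , _    , _ = node ts , cong (zero ∷_) (trans (sym (++-identityʳ _)) e)
  ... | ts , zero ∷ r  , e , _ , r∈C1 , _ = ⊥-elim (subst T (isC1-0∷ r) r∈C1)
  ... | ts , suc _ ∷ _ , e , s≤s () , _ , _

  ω-fibre-irrelevant : ∀ w → Irrelevant (Σ Tree λ t → ω t ≡ w)
  ω-fibre-irrelevant w (t , p) (t′ , p′) with ω-injective t t′ (trans p (sym p′))
  ω-fibre-irrelevant w (t , refl) (t , refl) | refl = refl

  treeCount : ∀ n w → Fin n ↔ (Σ Tree λ t → ω t ≡ w) → n ≡ (if isTreeWord w then 1 else 0)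
  treeCount n w i with isTreeWord w in eq
  ... | true  = Fin↔Irrelevant⇒≡1 n i (isTreeWord⇒ω w (subst T (sym eq) tt)) (ω-fibre-irrelevant w)
  ... | false = Fin↔⊥⇒≡0 n i λ { (t , refl) → subst T eq (ω-isTreeWord t) }

open TreeWords

module SeriesAlgebra {c ℓ : Level} (K : CommutativeRing c ℓ) where
  open CommutativeRing K
  open Series K
  open import Relation.Binary.Reasoning.Setoid setoid
  open import Algebra.Properties.CommutativeSemigroup +-commutativeSemigroup using (interchange)

  ∂ : ℕ → PS → PS
  ∂ a f u = f (a ∷ u)

  infixl 7 _∙_
  _∙_ : PS → PS → PS
  (f ∙ g) []      = f [] * g []
  (f ∙ g) (a ∷ w) = f [] * g (a ∷ w) + (∂ a f ∙ g) w

  ⊛≋∙ : ∀ f g → (f ⊛ g) ≋ (f ∙ g)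
  ⊛≋∙ f g []      = +-identityʳ _
  ⊛≋∙ f g (a ∷ w) = +-cong refl (trans (reflexive (≡.cong Σ' (≡.sym (map-∘ (splits w))))) (⊛≋∙ (∂ a f) g w))

  ∙-congˡ : ∀ {f f′} g → f ≋ f′ → (f ∙ g) ≋ (f′ ∙ g)
  ∙-congˡ g e []      = *-cong (e []) refl
  ∙-congˡ g e (a ∷ w) = +-cong (*-cong (e []) refl) (∙-congˡ g (λ u → e (a ∷ u)) w)

  ∙-congʳ : ∀ f {g g′} → g ≋ g′ → (f ∙ g) ≋ (f ∙ g′)
  ∙-congʳ f e []      = *-cong refl (e [])
  ∙-congʳ f e (a ∷ w) = +-cong (*-cong refl (e (a ∷ w))) (∙-congʳ (∂ a f) e w)

  ∙-scalarˡ : ∀ k f g → ((λ u → k * f u) ∙ g) ≋ (λ w → k * (f ∙ g) w)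
  ∙-scalarˡ k f g []      = *-assoc k (f []) (g [])
  ∙-scalarˡ k f g (a ∷ w) = begin
    k * f [] * g (a ∷ w) + ((λ u → k * f (a ∷ u)) ∙ g) w
      ≈⟨ +-cong (*-assoc k (f []) (g (a ∷ w))) (∙-scalarˡ k (∂ a f) g w) ⟩
    k * (f [] * g (a ∷ w)) + k * (∂ a f ∙ g) w
      ≈⟨ distribˡ k _ _ ⟨
    k * (f [] * g (a ∷ w) + (∂ a f ∙ g) w) ∎

  ∙-distribʳ : ∀ f f′ g → ((λ u → f u + f′ u) ∙ g) ≋ (λ w → (f ∙ g) w + (f′ ∙ g) w)
  ∙-distribʳ f f′ g []      = distribʳ (g []) (f []) (f′ [])
  ∙-distribʳ f f′ g (a ∷ w) = begin
    (f [] + f′ []) * g (a ∷ w) + ((λ u → f (a ∷ u) + f′ (a ∷ u)) ∙ g) w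
      ≈⟨ +-cong (distribʳ (g (a ∷ w)) (f []) (f′ [])) (∙-distribʳ (∂ a f) (∂ a f′) g w) ⟩
    (f [] * g (a ∷ w) + f′ [] * g (a ∷ w)) + ((∂ a f ∙ g) w + (∂ a f′ ∙ g) w)
      ≈⟨ interchange _ _ _ _ ⟩
    (f [] * g (a ∷ w) + (∂ a f ∙ g) w) + (f′ [] * g (a ∷ w) + (∂ a f′ ∙ g) w) ∎

  ∙-assoc : ∀ f g h → ((f ∙ g) ∙ h) ≋ (f ∙ (g ∙ h))
  ∙-assoc f g h []      = *-assoc (f []) (g []) (h [])
  ∙-assoc f g h (a ∷ w) = begin
    (f [] * g []) * h (a ∷ w) + ((λ u → f [] * g (a ∷ u) + (∂ a f ∙ g) u) ∙ h) w
      ≈⟨ +-cong refl (∙-distribʳ (λ u → f [] * g (a ∷ u)) (∂ a f ∙ g) h w) ⟩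
    (f [] * g []) * h (a ∷ w) + (((λ u → f [] * g (a ∷ u)) ∙ h) w + ((∂ a f ∙ g) ∙ h) w)
      ≈⟨ +-cong (*-assoc (f []) (g []) (h (a ∷ w)))
                (+-cong (∙-scalarˡ (f []) (∂ a g) h w) (∙-assoc (∂ a f) g h w)) ⟩
    f [] * (g [] * h (a ∷ w)) + (f [] * (∂ a g ∙ h) w + (∂ a f ∙ (g ∙ h)) w)
      ≈⟨ +-assoc _ _ _ ⟨
    (f [] * (g [] * h (a ∷ w)) + f [] * (∂ a g ∙ h) w) + (∂ a f ∙ (g ∙ h)) w
      ≈⟨ +-cong (distribˡ (f []) _ _) refl ⟨
    f [] * (g [] * h (a ∷ w) + (∂ a g ∙ h) w) + (∂ a f ∙ (g ∙ h)) w ∎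

  ε : PS
  ε []      = 1#
  ε (_ ∷ _) = 0#

  ∙-zeroˡ : ∀ {z} g → z ≋ (λ _ → 0#) → (z ∙ g) ≋ (λ _ → 0#)
  ∙-zeroˡ g z≈0 []      = trans (*-cong (z≈0 []) refl) (zeroˡ _)
  ∙-zeroˡ g z≈0 (a ∷ w) =
    trans (+-cong (trans (*-cong (z≈0 []) refl) (zeroˡ _)) (∙-zeroˡ g (λ u → z≈0 (a ∷ u)) w))
          (+-identityˡ 0#)

  ∙-identityˡ : ∀ {e} g → e ≋ ε → (e ∙ g) ≋ g
  ∙-identityˡ g e≈ε []      = trans (*-cong (e≈ε []) refl) (*-identityˡ _)
  ∙-identityˡ g e≈ε (a ∷ w) =
    trans (+-cong (trans (*-cong (e≈ε []) refl) (*-identityˡ _)) (∙-zeroˡ g (λ u → e≈ε (a ∷ u)) w))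
          (+-identityʳ _)

  ∙-identityʳ : ∀ f → (f ∙ ε) ≋ f
  ∙-identityʳ f []      = *-identityʳ _
  ∙-identityʳ f (a ∷ w) = trans (+-cong (zeroʳ _) (∙-identityʳ (∂ a f) w)) (+-identityˡ _)

  invAll≡map : ∀ f w → invAll f w ≡ map (inv₁ f ∘ proj₂) (splits w)
  invAll≡map f []      = ≡.refl
  invAll≡map f (a ∷ w) = ≡.cong (inv₁ f (a ∷ w) ∷_) (≡.trans (invAll≡map f w) (map-∘ (splits w)))

  inv₁-∷ : ∀ f a w → inv₁ f (a ∷ w) ≡ - (∂ a f ⊛ inv₁ f) w
  inv₁-∷ f a w = ≡.cong (λ xs → - Σ' xs)
    (≡.trans (≡.cong (zipWith _ (splits w)) (invAll≡map f w))
             (zipWith-map-self _ (inv₁ f ∘ proj₂) (splits w)))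

  inv₁-inverseʳ : ∀ f → f [] ≈ 1# → (f ∙ inv₁ f) ≋ ε
  inv₁-inverseʳ f f[]≈1 []      = trans (*-cong f[]≈1 refl) (*-identityˡ _)
  inv₁-inverseʳ f f[]≈1 (a ∷ w) = begin
    f [] * inv₁ f (a ∷ w) + (∂ a f ∙ inv₁ f) w
      ≈⟨ +-cong (*-cong f[]≈1 (reflexive (inv₁-∷ f a w))) (sym (⊛≋∙ (∂ a f) (inv₁ f) w)) ⟩
    1# * (- x) + x                  ≈⟨ +-cong (*-identityˡ _) refl ⟩
    - x + x                         ≈⟨ -‿inverseˡ x ⟩
    0#                              ∎
    where x = (∂ a f ⊛ inv₁ f) w

  -- inv₁ (inv₁ f) is a right inverse of inv₁ f, and the usual argument shows it equals f.
  inv₁-inverseˡ : ∀ f → f [] ≈ 1# → (inv₁ f ∙ f) ≋ ε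
  inv₁-inverseˡ f f[]≈1 w = trans (∙-congʳ g f≈g′ w) (inv₁-inverseʳ g refl w)
    where
    g = inv₁ f
    g′ = inv₁ g
    f≈g′ : f ≋ g′
    f≈g′ u = begin
      f u             ≈⟨ ∙-identityʳ f u ⟨
      (f ∙ ε) u       ≈⟨ ∙-congʳ f (inv₁-inverseʳ g refl) u ⟨
      (f ∙ (g ∙ g′)) u ≈⟨ ∙-assoc f g g′ u ⟨
      ((f ∙ g) ∙ g′) u ≈⟨ ∙-congˡ g′ (inv₁-inverseʳ f f[]≈1) u ⟩
      (ε ∙ g′) u      ≈⟨ ∙-identityˡ g′ (λ _ → refl) u ⟩
      g′ u            ∎

  ⟦_⟧ : Bool → Carrier
  ⟦ b ⟧ = if b then 1# else 0#

  if-0 : ∀ b {x} → x ≈ 0# → (if b then x else 0#) ≈ 0#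
  if-0 true  x≈0 = x≈0
  if-0 false _   = refl

  if-⟦∧⟧ : ∀ b y z → (if b then ⟦ y ∧ z ⟧ else 0#) ≈ (if y then (if b then ⟦ z ⟧ else 0#) else 0#)
  if-⟦∧⟧ false false z = refl
  if-⟦∧⟧ false true  z = refl
  if-⟦∧⟧ true  false z = refl
  if-⟦∧⟧ true  true  z = refl

  D : PS
  D v = ⟦ isC1After 0 v ⟧

  ⟦isC1-0∷⟧ : ∀ v → ⟦ isC1 (0 ∷ v) ⟧ ≈ 0#
  ⟦isC1-0∷⟧ v = reflexive (≡.cong ⟦_⟧ (isC1-0∷ v))

  1*x+y≈x : ∀ x {y} → y ≈ 0# → 1# * x + y ≈ x
  1*x+y≈x x y≈0 = trans (+-cong (*-identityˡ x) y≈0) (+-identityʳ x)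

  1*0+y≈y : ∀ y → 1# * 0# + y ≈ y
  1*0+y≈y y = trans (+-cong (zeroʳ 1#) refl) (+-identityˡ y)

  σC1-after-∙-D : ∀ m w → ((λ u → σ C1 (suc (suc m) ∷ u)) ∙ D) w ≈ ⟦ isC1After (suc (suc m)) w ⟧
  σC1-after-∙-D m []                 = *-identityʳ _
  σC1-after-∙-D m (zero ∷ w)         = 1*x+y≈x 0# (∙-zeroˡ D (λ _ → refl) w)
  σC1-after-∙-D m (suc zero ∷ w)     =
    1*x+y≈x _ (∙-zeroˡ D (λ u → if-0 (allPos u) (⟦isC1-0∷⟧ (map pred u))) w)
  σC1-after-∙-D m (suc (suc b) ∷ w)  = begin
    1# * 0# + ((λ u → σ C1 (suc (suc m) ∷ suc (suc b) ∷ u)) ∙ D) w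
      ≈⟨ 1*0+y≈y _ ⟩
    ((λ u → σ C1 (suc (suc m) ∷ suc (suc b) ∷ u)) ∙ D) w
      ≈⟨ ∙-congˡ D (λ u → if-⟦∧⟧ (allPos u) (b <ᵇ suc (suc m)) (isC1 (suc b ∷ map pred u))) w ⟩
    ((λ u → if b <ᵇ suc (suc m) then σ C1 (suc (suc b) ∷ u) else 0#) ∙ D) w
      ≈⟨ continue (b <ᵇ suc (suc m)) ⟩
    ⟦ (b <ᵇ suc (suc m)) ∧ isC1After (suc (suc b)) w ⟧ ∎
    where
    continue : ∀ y → ((λ u → if y then σ C1 (suc (suc b) ∷ u) else 0#) ∙ D) w
                     ≈ ⟦ y ∧ isC1After (suc (suc b)) w ⟧
    continue true  = σC1-after-∙-D b w
    continue false = ∙-zeroˡ D (λ _ → refl) w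

  -- Factor a word of 𝒞⁽¹⁾ before its first letter 1.
  σC1∙D≋C1 : (σ C1 ∙ D) ≋ C1
  σC1∙D≋C1 []                = *-identityʳ _
  σC1∙D≋C1 (zero ∷ w)        = trans (1*x+y≈x 0# (∙-zeroˡ D (λ _ → refl) w)) (sym (⟦isC1-0∷⟧ w))
  σC1∙D≋C1 (suc zero ∷ w)    =
    trans (1*x+y≈x _ (∙-zeroˡ D (λ u → if-0 (allPos u) (⟦isC1-0∷⟧ (map pred u))) w))
          (reflexive (≡.cong ⟦_⟧ (≡.sym (isC1-∷ 1 w))))
  σC1∙D≋C1 (suc (suc b) ∷ w) =
    trans (1*0+y≈y _) (trans (σC1-after-∙-D b w) (reflexive (≡.cong ⟦_⟧ (≡.sym (isC1-∷ (suc (suc b)) w)))))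

  inv₁σC1∙C1≋D : (inv₁ (σ C1) ∙ C1) ≋ D
  inv₁σC1∙C1≋D w = begin
    (inv₁ (σ C1) ∙ C1) w          ≈⟨ ∙-congʳ (inv₁ (σ C1)) σC1∙D≋C1 w ⟨
    (inv₁ (σ C1) ∙ (σ C1 ∙ D)) w  ≈⟨ ∙-assoc (inv₁ (σ C1)) (σ C1) D w ⟨
    ((inv₁ (σ C1) ∙ σ C1) ∙ D) w  ≈⟨ ∙-identityˡ D (inv₁-inverseˡ (σ C1) refl) w ⟩
    D w                           ∎

  X₀∙D≋treeWords : (X₀ ∙ D) ≋ (λ w → ⟦ isTreeWord w ⟧)
  X₀∙D≋treeWords []          = zeroˡ _
  X₀∙D≋treeWords (zero ∷ w)  = trans (+-cong (zeroˡ _) (∙-identityˡ D ∂₀X₀≋ε w)) (+-identityˡ _)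
    where
    ∂₀X₀≋ε : ∂ 0 X₀ ≋ ε
    ∂₀X₀≋ε []      = refl
    ∂₀X₀≋ε (_ ∷ _) = refl
  X₀∙D≋treeWords (suc _ ∷ w) = trans (+-cong (zeroˡ _) (∙-zeroˡ D (λ _ → refl) w)) (+-identityˡ _)

  treeSeries : ((X₀ ⊛ inv₁ (σ C1)) ⊛ C1) ≋ (λ w → ⟦ isTreeWord w ⟧)
  treeSeries w = begin
    ((X₀ ⊛ inv₁ (σ C1)) ⊛ C1) w   ≈⟨ ⊛≋∙ (X₀ ⊛ inv₁ (σ C1)) C1 w ⟩
    ((X₀ ⊛ inv₁ (σ C1)) ∙ C1) w   ≈⟨ ∙-congˡ C1 (⊛≋∙ X₀ (inv₁ (σ C1))) w ⟩
    ((X₀ ∙ inv₁ (σ C1)) ∙ C1) w   ≈⟨ ∙-assoc X₀ (inv₁ (σ C1)) C1 w ⟩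
    (X₀ ∙ (inv₁ (σ C1) ∙ C1)) w   ≈⟨ ∙-congʳ X₀ inv₁σC1∙C1≋D w ⟩
    (X₀ ∙ D) w                    ≈⟨ X₀∙D≋treeWords w ⟩
    ⟦ isTreeWord w ⟧              ∎

  natToK-if : ∀ b → natToK (if b then 1 else 0) ≈ ⟦ b ⟧
  natToK-if true  = +-identityʳ 1#
  natToK-if false = refl

mainTheorem7 : {c ℓ : Level} (K : CommutativeRing c ℓ) →
    let open Series K in
    IsField → CharZero →
    (A : PS) → IsTreeLanguage A →
    A ≋ ((X₀ ⊛ inv₁ (σ C1)) ⊛ C1)
mainTheorem7 K _ _ A (count , count↔trees , A≈count) w = begin
  A w                                       ≈⟨ A≈count w ⟩
  natToK (count w)                          ≡⟨ ≡.cong natToK (treeCount (count w) w (count↔trees w)) ⟩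
  natToK (if isTreeWord w then 1 else 0)    ≈⟨ natToK-if (isTreeWord w) ⟩
  ⟦ isTreeWord w ⟧                          ≈⟨ treeSeries w ⟨
  ((X₀ ⊛ inv₁ (σ C1)) ⊛ C1) w               ∎
  where
  open CommutativeRing K
  open Series K
  open SeriesAlgebra K
  open import Relation.Binary.Reasoning.Setoid setoid
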